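{- Let $n$ be an odd perfect square. Then $D_{S(n)^*}\geq 5$.
   Context: $\mathbb Z_n=\mathbb Z/n\mathbb Z$; $S(n)^*=\{x^2:x\in\mathbb Z_n\}\setminus\{0\}$. For $A\subseteq\mathbb Z_n$, a subsequence $T$ of a sequence $(x_1,\dots,x_k)$ in $\mathbb Z_n$, with nonempty index set $I$, is an $A$-weighted zero-sum subsequence if there exist $a_i\in A$ ($i\in I$) with $\sum_{i\in I}a_ix_i=0$. $D_{S(n)^*}$ is the least positive integer $k$ such that every sequence of length $k$ in $\mathbb Z_n$ has an $S(n)^*$-weighted zero-sum subsequence. -}

module Defs where

open import Data.Nat using (ℕ; zero; suc; _+_; _*_; _<_; _≤_; NonZero)
open import Data.Nat.DivMod using (_%_)
open import Data.Fin using (Fin; zero; suc)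
open import Data.Fin.Subset using (Subset; _∈_; Nonempty; Side; inside; outside)
open import Data.Vec using (lookup)
open import Data.Product using (Σ; _×_; ∃)
open import Relation.Binary.PropositionalEquality using (_≡_)

-- Elements of ℤ_n are represented by their canonical representatives 0 ≤ a < n.

sumFin : (k : ℕ) → (Fin k → ℕ) → ℕ
sumFin zero    f = 0
sumFin (suc k) f = f zero + sumFin k (λ i → f (suc i))

InSstar : (n : ℕ) → .{{NonZero n}} → ℕ → Set
InSstar n a = a < n × ¬0 × Σ ℕ (λ x → x < n × (x * x) % n ≡ a)
  where
  ¬0 : Set
  ¬0 = 0 < a

sel : Side → ℕ → ℕ
sel inside  m = m
sel outside m = 0

-- The sequence x (length k, in ℤ_n) has an A-weighted zero-sum subsequence,
-- for A = S(n)*: a nonempty index set I and weights a_i ∈ S(n)* (i ∈ I)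
-- with Σ_{i∈I} a_i x_i = 0 in ℤ_n.
HasSstarZeroSum : (n : ℕ) → .{{NonZero n}} → (k : ℕ) → (Fin k → ℕ) → Set
HasSstarZeroSum n k x =
  Σ (Subset k) λ I → Nonempty I ×
  Σ (Fin k → ℕ) λ a → (∀ i → i ∈ I → InSstar n (a i)) ×
  (sumFin k (λ i → sel (lookup I i) (a i * x i)) % n ≡ 0)

AllHaveZeroSum : (n : ℕ) → .{{NonZero n}} → ℕ → Set
AllHaveZeroSum n k = (x : Fin k → ℕ) → (∀ i → x i < n) → HasSstarZeroSum n k x

IsDSstar : (n : ℕ) → .{{NonZero n}} → ℕ → Set
IsDSstar n d = 0 < d × AllHaveZeroSum n d × (∀ k → 0 < k → AllHaveZeroSum n k → d ≤ k)

-- Write n = m², let r be the radical of m and, using that m is odd and the Chinese remainder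
-- theorem, choose u with -u a quadratic non-residue modulo every prime p ∣ m. Weights in
-- S(n)* are nonzero squares, so an S(n)*-weighted zero-sum of (1, u, r, ru) gives y with
-- y₁² + u y₂² + r (y₃² + u y₄²) ≡ 0 mod m² and some yᵢ² ≢ 0 mod m². For p ∣ m, anisotropy of
-- y² + u z² mod p and p ∥ r force p ∣ yᵢ for all i; dividing by p gives the same congruence
-- modulo (m/p)², so by descent m ∣ yᵢ, a contradiction. The tails of (1, u, r, ru) have no
-- zero-sum either, hence D_{S(n)*} ≥ 5.
module Submission where

open import Data.Empty using (⊥-elim)
open import Data.Fin using (Fin; zero; suc; toℕ; fromℕ<) renaming (_<_ to _<ᶠ_)
import Data.Fin.Properties as Fin
open import Data.List.Relation.Unary.All using (All; []; _∷_)
open import Data.Nat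
open import Data.Nat.Coprimality using (Coprime; coprime-Bézout)
open import Data.Nat.DivMod
open import Data.Nat.Divisibility
open import Data.Nat.GCD using (module Bézout)
open import Data.Nat.ListAction using (product)
open import Data.Nat.Primality
open import Data.Nat.Primality.Factorisation using (factorise; PrimeFactorisation)
open import Data.Nat.Properties
open import Algebra.Properties.CommutativeSemigroup *-commutativeSemigroup using (xy∙z≈xz∙y; xy∙z≈y∙xz; x∙yz≈y∙xz)
open import Data.Nat.Tactic.RingSolver using (solve-∀)
open import Data.Product
open import Data.Fin.Subset using (inside; outside; _∈_)
open import Data.Vec using (_∷_; lookup; there)
open import Data.Vec.Properties using ([]=⇒lookup; lookup⇒[]=)
open import Data.Sum using (_⊎_; inj₁; inj₂)
open import Function using (_∘_)
open import Relation.Nullary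
open import Relation.Binary.PropositionalEquality

open import Defs

infix 4 _≡_[mod_]

_≡_[mod_] : ℕ → ℕ → (p : ℕ) → .{{NonZero p}} → Set
a ≡ b [mod p ] = a % p ≡ b % p

module _ {p : ℕ} .{{_ : NonZero p}} where

  +-cong[mod] : ∀ {a b c d} → a ≡ b [mod p ] → c ≡ d [mod p ] → a + c ≡ b + d [mod p ]
  +-cong[mod] {a = a} {b} {c} {d} a≡b c≡d = begin
    (a + c) % p         ≡⟨ %-distribˡ-+ a c p ⟩
    (a % p + c % p) % p ≡⟨ cong₂ (λ x y → (x + y) % p) a≡b c≡d ⟩
    (b % p + d % p) % p ≡⟨ %-distribˡ-+ b d p ⟨
    (b + d) % p         ∎
    where open ≡-Reasoning

  *-cong[mod] : ∀ {a b c d} → a ≡ b [mod p ] → c ≡ d [mod p ] → a * c ≡ b * d [mod p ]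
  *-cong[mod] {a = a} {b} {c} {d} a≡b c≡d = begin
    (a * c) % p           ≡⟨ %-distribˡ-* a c p ⟩
    (a % p * (c % p)) % p ≡⟨ cong₂ (λ x y → (x * y) % p) a≡b c≡d ⟩
    (b % p * (d % p)) % p ≡⟨ %-distribˡ-* b d p ⟨
    (b * d) % p           ∎
    where open ≡-Reasoning

  ∣⇒≡0[mod] : ∀ {a} → p ∣ a → a ≡ 0 [mod p ]
  ∣⇒≡0[mod] {a = a} p∣a = trans (n∣m⇒m%n≡0 a p p∣a) (sym (m*n%n≡0 0 p))

  ≡0[mod]⇒∣ : ∀ {a} → a ≡ 0 [mod p ] → p ∣ a
  ≡0[mod]⇒∣ {a} a≡0 = m%n≡0⇒n∣m a p (trans a≡0 (m*n%n≡0 0 p))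

  %≡[mod] : ∀ a → a % p ≡ a [mod p ]
  %≡[mod] a = m%n%n≡m%n a p

prime-induction : ∀ {ℓ} (P : ℕ → Set ℓ) → P 1 → (∀ {p k} → Prime p → P k → P (p * k)) →
                  ∀ m .{{_ : NonZero m}} → P m
prime-induction P base step m = subst P (sym isFactorisation) (go factorsPrime)
  where
  open PrimeFactorisation (factorise m)
  go : ∀ {ps} → All Prime ps → P (product ps)
  go []         = base
  go (pp ∷ pps) = step pp (go pps)

prime∤1 : ∀ {p} → Prime p → ¬ p ∣ 1
prime∤1 pp p∣1 = nonTrivial⇒≢1 {{prime⇒nonTrivial pp}} (∣1⇒≡1 p∣1)

prime∣prime⇒≡ : ∀ {p q} → Prime p → Prime q → p ∣ q → p ≡ q
prime∣prime⇒≡ pp qq p∣q with prime⇒irreducible qq p∣q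
... | inj₁ refl = ⊥-elim (prime∤1 pp ∣-refl)
... | inj₂ p≡q  = p≡q

prime∣*⇒≡⊎∣ : ∀ {p q k} → Prime p → Prime q → q ∣ p * k → q ≡ p ⊎ q ∣ k
prime∣*⇒≡⊎∣ {p} {k = k} pp qq q∣pk with euclidsLemma p k qq q∣pk
... | inj₁ q∣p = inj₁ (prime∣prime⇒≡ qq pp q∣p)
... | inj₂ q∣k = inj₂ q∣k

prime∣*⇒∣ : ∀ {p q k} → Prime p → Prime q → p ∣ k → q ∣ p * k → q ∣ k
prime∣*⇒∣ pp qq p∣k q∣pk with prime∣*⇒≡⊎∣ pp qq q∣pk
... | inj₁ refl = p∣k
... | inj₂ q∣k  = q∣k

prime∤⇒coprime : ∀ {p a} → Prime p → ¬ p ∣ a → Coprime p a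
prime∤⇒coprime pp p∤a (d∣p , d∣a) with prime⇒irreducible pp d∣p
... | inj₁ d≡1 = d≡1
... | inj₂ refl = ⊥-elim (p∤a d∣a)

inverse[mod] : ∀ {p} .{{_ : NonZero p}} → Prime p → ∀ {a} → ¬ p ∣ a → ∃ λ w → a * w ≡ 1 [mod p ]
inverse[mod] {p@(suc q)} pp {a} p∤a with coprime-Bézout (prime∤⇒coprime pp p∤a)
... | Bézout.-+ x y 1+xp≡ya = y , (begin
  (a * y) % p     ≡⟨ cong (_% p) (trans (*-comm a y) (sym 1+xp≡ya)) ⟩
  (1 + x * p) % p ≡⟨ [m+kn]%n≡m%n 1 x p ⟩
  1 % p           ∎)
  where open ≡-Reasoning
... | Bézout.+- x y 1+ya≡xp = y * q , (begin
  (a * (y * q)) % p             ≡⟨ [m+kn]%n≡m%n (a * (y * q)) x p ⟨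
  (a * (y * q) + x * p) % p     ≡⟨ cong (_% p) identity ⟩
  (1 + (y * a) * p) % p         ≡⟨ [m+kn]%n≡m%n 1 (y * a) p ⟩
  1 % p                         ∎)
  where
  open ≡-Reasoning
  -- a y ≡ -1, so a (y (p - 1)) ≡ 1
  expand : ∀ a y q → a * (y * q) + (1 + y * a) ≡ 1 + y * a * suc q
  expand = solve-∀
  identity : a * (y * q) + x * p ≡ 1 + y * a * p
  identity = trans (cong (a * (y * q) +_) (sym 1+ya≡xp)) (expand a y q)

-- Every square mod p is the square of some z < p - 1, since (p - 1)² ≡ 1²; so at most
-- p - 1 of the p residues are squares.
nonresidue-exists : ∀ {p} .{{_ : NonZero p}} → 2 < p → ∃ λ t → ∀ y → ¬ y * y ≡ t [mod p ]
nonresidue-exists {p@(suc q@(suc (suc r)))} (s≤s (s≤s (s≤s _)))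
  with Fin.all? (λ (t : Fin p) → Fin.any? (λ (z : Fin q) → (toℕ z * toℕ z) % p ≟ toℕ t))
... | yes allSquares = ⊥-elim (rootsCollide (Fin.pigeonhole ≤-refl root))
  where
  root : Fin p → Fin q
  root t = proj₁ (allSquares t)
  root-injective : ∀ {s t} → root s ≡ root t → s ≡ t
  root-injective {s} {t} eq = Fin.toℕ-injective (begin
    toℕ s                                    ≡⟨ proj₂ (allSquares s) ⟨
    (toℕ (root s) * toℕ (root s)) % p        ≡⟨ cong (λ z → (toℕ z * toℕ z) % p) eq ⟩
    (toℕ (root t) * toℕ (root t)) % p        ≡⟨ proj₂ (allSquares t) ⟩
    toℕ t                                    ∎)
    where open ≡-Reasoning
  rootsCollide : ¬ ∃₂ λ s t → s <ᶠ t × root s ≡ root t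
  rootsCollide (s , t , s<t , eq) = <-irrefl (cong toℕ (root-injective eq)) s<t
... | no notAllSquares = toℕ t , λ y y²≡t → nonSquare (smallRoot y y²≡t)
  where
  witness = Fin.¬∀⟶∃¬ p _ (λ t → Fin.any? (λ (z : Fin q) → (toℕ z * toℕ z) % p ≟ toℕ t)) notAllSquares
  t = proj₁ witness
  nonSquare = proj₂ witness
  q²≡1 : q * q ≡ 1 + suc r * p
  q²≡1 = expanded r
    where
    expanded : ∀ r → (2 + r) * (2 + r) ≡ 1 + suc r * (3 + r)
    expanded = solve-∀
  smallRoot : ∀ y → y * y ≡ toℕ t [mod p ] → ∃ λ (z : Fin q) → (toℕ z * toℕ z) % p ≡ toℕ t
  smallRoot y y²≡t with y % p <? q
  ... | yes y%p<q = fromℕ< y%p<q , (begin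
    (toℕ (fromℕ< y%p<q) * toℕ (fromℕ< y%p<q)) % p ≡⟨ cong (λ z → (z * z) % p) (Fin.toℕ-fromℕ< y%p<q) ⟩
    (y % p * (y % p)) % p                          ≡⟨ %-distribˡ-* y y p ⟨
    (y * y) % p                                    ≡⟨ y²≡t ⟩
    toℕ t % p                                      ≡⟨ m<n⇒m%n≡m (Fin.toℕ<n t) ⟩
    toℕ t                                          ∎)
    where open ≡-Reasoning
  ... | no y%p≮q = suc zero , (begin
    1 % p                   ≡⟨ [m+kn]%n≡m%n 1 (suc r) p ⟨
    (1 + suc r * p) % p     ≡⟨ cong (_% p) q²≡1 ⟨
    (q * q) % p             ≡⟨ cong (λ z → (z * z) % p) y%p≡q ⟨
    (y % p * (y % p)) % p   ≡⟨ %-distribˡ-* y y p ⟨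
    (y * y) % p             ≡⟨ y²≡t ⟩
    toℕ t % p               ≡⟨ m<n⇒m%n≡m (Fin.toℕ<n t) ⟩
    toℕ t                   ∎)
    where
    open ≡-Reasoning
    y%p≡q : y % p ≡ q
    y%p≡q = ≤-antisym (≤-pred (m%n<n y p)) (≮⇒≥ y%p≮q)

norm : ℕ → ℕ → ℕ → ℕ
norm u y z = y * y + u * (z * z)

-- For an odd prime p this says that -u is a quadratic non-residue mod p.
Anisotropic : ℕ → ℕ → Set
Anisotropic p u = ∀ y z → p ∣ norm u y z → p ∣ y × p ∣ z

norm-scale : ∀ u y z p → norm u (y * p) (z * p) ≡ p * p * norm u y z
norm-scale = expanded
  where
  expanded : ∀ u y z p → y * p * (y * p) + u * (z * p * (z * p)) ≡ p * p * (y * y + u * (z * z))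
  expanded = solve-∀

-- If z is invertible mod p then y² + u z² ≡ 0 makes (y z⁻¹)² ≡ -u ≡ t a square.
nonresidue⇒anisotropic : ∀ {p t u} .{{_ : NonZero p}} → Prime p →
                         (∀ y → ¬ y * y ≡ t [mod p ]) → u + t ≡ 0 [mod p ] → Anisotropic p u
nonresidue⇒anisotropic {p} {t} {u} pp nonSquare u+t≡0 y z p∣norm = p∣y , p∣z
  where
  p∣z : p ∣ z
  p∣z with p ∣? z
  ... | yes p∣z = p∣z
  ... | no p∤z = ⊥-elim (nonSquare (y * w) yw²≡t)
    where
    w = proj₁ (inverse[mod] pp p∤z)
    zw≡1 = proj₂ (inverse[mod] pp p∤z)
    rescale : norm u y z * (w * w) ≡ norm u (y * w) (z * w)
    rescale = trans (*-comm (norm u y z) (w * w)) (sym (norm-scale u y z w))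
    norm[yw,zw]≡0 : norm u (y * w) (z * w) ≡ 0 [mod p ]
    norm[yw,zw]≡0 = begin
      norm u (y * w) (z * w) % p  ≡⟨ cong (_% p) rescale ⟨
      (norm u y z * (w * w)) % p  ≡⟨ *-cong[mod] {c = w * w} (∣⇒≡0[mod] p∣norm) refl ⟩
      0 % p                       ∎
      where open ≡-Reasoning
    yw²+u≡0 : y * w * (y * w) + u ≡ 0 [mod p ]
    yw²+u≡0 = begin
      (y * w * (y * w) + u) % p      ≡⟨ +-cong[mod] {a = y * w * (y * w)} refl (cong (_% p) (*-identityʳ u)) ⟨
      (y * w * (y * w) + u * 1) % p  ≡⟨ +-cong[mod] {a = y * w * (y * w)} refl (*-cong[mod] {a = u} refl (*-cong[mod] zw≡1 zw≡1)) ⟨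
      norm u (y * w) (z * w) % p     ≡⟨ norm[yw,zw]≡0 ⟩
      0 % p                          ∎
      where open ≡-Reasoning
    yw²≡t : y * w * (y * w) ≡ t [mod p ]
    yw²≡t = begin
      (y * w * (y * w)) % p          ≡⟨ cong (_% p) (+-identityʳ _) ⟨
      (y * w * (y * w) + 0) % p      ≡⟨ +-cong[mod] {a = y * w * (y * w)} refl u+t≡0 ⟨
      (y * w * (y * w) + (u + t)) % p ≡⟨ cong (_% p) (+-assoc (y * w * (y * w)) u t) ⟨
      (y * w * (y * w) + u + t) % p  ≡⟨ +-cong[mod] {c = t} yw²+u≡0 refl ⟩
      t % p                          ∎
      where open ≡-Reasoning
  p∣y : p ∣ y
  p∣y with euclidsLemma y y pp (∣m+n∣m⇒∣n (subst (p ∣_) (+-comm (y * y) _) p∣norm) (∣n⇒∣m*n u (∣m⇒∣m*n z p∣z)))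
  ... | inj₁ p∣y = p∣y
  ... | inj₂ p∣y = p∣y

anisotropic-resp : ∀ {p u v} .{{_ : NonZero p}} → u ≡ v [mod p ] → Anisotropic p u → Anisotropic p v
anisotropic-resp {p} {u} {v} u≡v aniso y z p∣norm = aniso y z (≡0[mod]⇒∣ (begin
  norm u y z % p ≡⟨ +-cong[mod] {a = y * y} refl (*-cong[mod] {c = z * z} u≡v refl) ⟩
  norm v y z % p ≡⟨ ∣⇒≡0[mod] p∣norm ⟩
  0 % p          ∎))
  where open ≡-Reasoning

*-pred+≡* : ∀ m n .{{_ : NonZero n}} → m * pred n + m ≡ m * n
*-pred+≡* m (suc n) = trans (+-comm (m * n) m) (sym (*-suc m n))

anisotropic-exists : ∀ {p} .{{_ : NonZero p}} → Prime p → 2 < p → ∃ (Anisotropic p)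
anisotropic-exists {p} pp 2<p with nonresidue-exists 2<p
... | t , nonSquare = t * pred p , nonresidue⇒anisotropic pp nonSquare (begin
  (t * pred p + t) % p ≡⟨ cong (_% p) (*-pred+≡* t p) ⟩
  (t * p) % p          ≡⟨ ∣⇒≡0[mod] (n∣m*n t) ⟩
  0 % p                ∎)
  where open ≡-Reasoning

linear-congruence-solvable : ∀ {p k} .{{_ : NonZero p}} → Prime p → ¬ p ∣ k →
                             ∀ a b → ∃ λ x → a + k * x ≡ b [mod p ]
linear-congruence-solvable {p} {k} pp p∤k a b = w * c , (begin
  (a + k * (w * c)) % p ≡⟨ cong (λ x → (a + x) % p) (*-assoc k w c) ⟨
  (a + k * w * c) % p   ≡⟨ +-cong[mod] {a = a} refl (*-cong[mod] {c = c} kw≡1 refl) ⟩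
  (a + 1 * c) % p       ≡⟨ cong (_% p) rearrange ⟩
  (b + a * p) % p       ≡⟨ [m+kn]%n≡m%n b a p ⟩
  b % p                 ∎)
  where
  open ≡-Reasoning
  -- c ≡ b - a, as pred p ≡ -1
  c = a * pred p + b
  w = proj₁ (inverse[mod] pp p∤k)
  kw≡1 = proj₂ (inverse[mod] pp p∤k)
  shuffle : ∀ a b x → a + 1 * (x + b) ≡ b + (x + a)
  shuffle = solve-∀
  rearrange : a + 1 * c ≡ b + a * p
  rearrange = trans (shuffle a b (a * pred p)) (cong (b +_) (*-pred+≡* a p))

odd-prime>2 : ∀ {p} → Prime p → p ≢ 2 → 2 < p
odd-prime>2 {p} pp p≢2 = ≤∧≢⇒< (nonTrivial⇒n>1 p {{prime⇒nonTrivial pp}}) (p≢2 ∘ sym)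

AnisotropicAt : ℕ → ℕ → Set
AnisotropicAt m u = ∀ p → Prime p → p ∣ m → Anisotropic p u

anisotropic-everywhere : ∀ m .{{_ : NonZero m}} → ¬ 2 ∣ m → ∃ (AnisotropicAt m)
anisotropic-everywhere = prime-induction (λ m → ¬ 2 ∣ m → ∃ (AnisotropicAt m)) base step
  where
  base : ¬ 2 ∣ 1 → ∃ (AnisotropicAt 1)
  base _ = 0 , λ p pp p∣1 → ⊥-elim (prime∤1 pp p∣1)
  step : ∀ {p k} → Prime p → (¬ 2 ∣ k → ∃ (AnisotropicAt k)) → ¬ 2 ∣ p * k → ∃ (AnisotropicAt (p * k))
  step {p} {k} pp ih 2∤pk with ih (2∤pk ∘ ∣n⇒∣m*n p) | p ∣? k
  ... | u , anisoₖ | yes p∣k = u , λ q qq q∣pk → anisoₖ q qq (prime∣*⇒∣ pp qq p∣k q∣pk)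
  ... | u , anisoₖ | no p∤k = u + k * x , aniso
    where
    instance _ = prime⇒nonZero pp
    anisoₚ = anisotropic-exists pp (odd-prime>2 pp (λ { refl → 2∤pk (m∣m*n k) }))
    solution = linear-congruence-solvable pp p∤k u (proj₁ anisoₚ)
    x = proj₁ solution
    aniso : AnisotropicAt (p * k) (u + k * x)
    aniso q qq q∣pk with prime∣*⇒≡⊎∣ pp qq q∣pk
    ... | inj₁ refl = anisotropic-resp (sym (proj₂ solution)) (proj₂ anisoₚ)
    ... | inj₂ q∣k  = anisotropic-resp (sym (%-remove-+ʳ u (∣m⇒∣m*n x q∣k))) (anisoₖ q qq q∣k)
      where instance _ = prime⇒nonZero qq

infix 4 _∥_

_∥_ : ℕ → ℕ → Set
p ∥ r = ∃ λ s → r ≡ s * p × ¬ p ∣ s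

IsRadicalOf : ℕ → ℕ → Set
IsRadicalOf r m = r ∣ m × ∀ p → Prime p → p ∣ m → p ∥ r

radical-exists : ∀ m .{{_ : NonZero m}} → ∃ λ r → IsRadicalOf r m
radical-exists = prime-induction (λ m → ∃ λ r → IsRadicalOf r m) base step
  where
  base : ∃ λ r → IsRadicalOf r 1
  base = 1 , ∣-refl , λ p pp p∣1 → ⊥-elim (prime∤1 pp p∣1)
  step : ∀ {p k} → Prime p → ∃ (λ r → IsRadicalOf r k) → ∃ λ r → IsRadicalOf r (p * k)
  step {p} {k} pp (r , r∣k , exact) with p ∣? k
  ... | yes p∣k = r , ∣-trans r∣k (n∣m*n p) , λ q qq q∣pk → exact q qq (prime∣*⇒∣ pp qq p∣k q∣pk)
  ... | no p∤k = r * p , subst (r * p ∣_) (*-comm k p) (*-monoˡ-∣ p r∣k) , exact′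
    where
    exact′ : ∀ q → Prime q → q ∣ p * k → q ∥ r * p
    exact′ q qq q∣pk with prime∣*⇒≡⊎∣ pp qq q∣pk
    ... | inj₁ refl = r , refl , λ p∣r → p∤k (∣-trans p∣r r∣k)
    ... | inj₂ q∣k with exact q qq q∣k
    ...   | s , refl , q∤s = s * p , xy∙z≈xz∙y s q p , q∤sp
      where
      q∤sp : ¬ q ∣ s * p
      q∤sp q∣sp with euclidsLemma s p qq q∣sp
      ... | inj₁ q∣s = q∤s q∣s
      ... | inj₂ q∣p = p∤k (subst (_∣ k) (prime∣prime⇒≡ qq pp q∣p) q∣k)

form : ℕ → ℕ → ℕ → ℕ → ℕ → ℕ → ℕ
form r u a b c d = norm u a b + r * norm u c d

form-scale : ∀ r u a b c d p → form r u (a * p) (b * p) (c * p) (d * p) ≡ p * p * form r u a b c d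
form-scale r u a b c d p = begin
  norm u (a * p) (b * p) + r * norm u (c * p) (d * p) ≡⟨ cong₂ (λ x y → x + r * y) (norm-scale u a b p) (norm-scale u c d p) ⟩
  p * p * norm u a b + r * (p * p * norm u c d)       ≡⟨ cong (p * p * norm u a b +_) (x∙yz≈y∙xz r (p * p) _) ⟩
  p * p * norm u a b + p * p * (r * norm u c d)       ≡⟨ *-distribˡ-+ (p * p) _ _ ⟨
  p * p * form r u a b c d                            ∎
  where open ≡-Reasoning

DividesAll : ℕ → ℕ → ℕ → ℕ → ℕ → Set
DividesAll k a b c d = k ∣ a × k ∣ b × k ∣ c × k ∣ d

p²∣form⇒p∣ : ∀ {p r u} → Prime p → p ∥ r → Anisotropic p u →
             ∀ a b c d → p * p ∣ form r u a b c d → DividesAll p a b c d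
p²∣form⇒p∣ {p} {r} {u} pp (s , refl , p∤s) aniso a b c d p²∣form
  with aniso a b (∣m+n∣m⇒∣n (subst (p ∣_) (+-comm (norm u a b) _) p∣form) (∣m⇒∣m*n _ (n∣m*n s)))
  where p∣form = ∣-trans (n∣m*n p) p²∣form
... | divides-refl a′ , divides-refl b′ = n∣m*n a′ , n∣m*n b′ , aniso c d p∣norm[c,d]
  where
  instance _ = prime⇒nonZero pp
  p²∣r*norm : p * p ∣ s * p * norm u c d
  p²∣r*norm = ∣m+n∣m⇒∣n (subst (λ x → p * p ∣ x + s * p * norm u c d) (norm-scale u a′ b′ p) p²∣form) (m∣m*n _)
  p∣norm[c,d] : p ∣ norm u c d
  p∣norm[c,d] with euclidsLemma s _ pp (*-cancelˡ-∣ p (subst (p * p ∣_) (xy∙z≈y∙xz s p _) p²∣r*norm))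
  ... | inj₁ p∣s = ⊥-elim (p∤s p∣s)
  ... | inj₂ p∣norm = p∣norm

sumFin-cong[mod] : ∀ {n} .{{_ : NonZero n}} k {f g : Fin k → ℕ} →
                   (∀ i → f i ≡ g i [mod n ]) → sumFin k f ≡ sumFin k g [mod n ]
sumFin-cong[mod] zero    f≡g = refl
sumFin-cong[mod] (suc k) {f} {g} f≡g =
  +-cong[mod] {a = f zero} {g zero} (f≡g zero) (sumFin-cong[mod] k (f≡g ∘ suc))

weighted-term : ∀ {n} .{{_ : NonZero n}} s a c → (s ≡ inside → InSstar n a) →
                ∃ λ y → sel s (a * (c % n)) ≡ y * y * c [mod n ] × (s ≡ inside → ¬ n ∣ y * y)
weighted-term outside a c _ = 0 , refl , λ ()
weighted-term {n} inside a c weight with weight refl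
... | a<n , 0<a , y , _ , y²≡a = y , *-cong[mod] {a = a} {y * y} a≡y² (%≡[mod] c) , y²≢0
  where
  a≡y² : a ≡ y * y [mod n ]
  a≡y² = trans (m<n⇒m%n≡m a<n) (sym y²≡a)
  y²≢0 : inside ≡ inside → ¬ n ∣ y * y
  y²≢0 _ n∣y² = <-irrefl (trans (sym (n∣m⇒m%n≡0 _ n n∣y²)) y²≡a) 0<a

zeroSum⇒isotropic : ∀ {n} .{{_ : NonZero n}} {k} (c : Fin k → ℕ) → HasSstarZeroSum n k (λ i → c i % n) →
                    ∃ λ (y : Fin k → ℕ) → n ∣ sumFin k (λ i → y i * y i * c i) × ∃ λ i → ¬ n ∣ y i * y i
zeroSum⇒isotropic {n} {k} c (I , (i , i∈I) , a , weights , sum≡0) =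
  y , n∣sum , i , proj₂ (proj₂ (term i)) ([]=⇒lookup i∈I)
  where
  term : ∀ j → ∃ λ y → sel (lookup I j) (a j * (c j % n)) ≡ y * y * c j [mod n ] ×
                       (lookup I j ≡ inside → ¬ n ∣ y * y)
  term j = weighted-term (lookup I j) (a j) (c j) (weights j ∘ lookup⇒[]= j I)
  y : Fin k → ℕ
  y = proj₁ ∘ term
  n∣sum : n ∣ sumFin k (λ j → y j * y j * c j)
  n∣sum = m%n≡0⇒n∣m _ n (trans (sym (sumFin-cong[mod] k (proj₁ ∘ proj₂ ∘ term))) sum≡0)

zeroSum-tail : ∀ {n} .{{_ : NonZero n}} {k} {x : Fin (suc k) → ℕ} →
               HasSstarZeroSum n k (x ∘ suc) → HasSstarZeroSum n (suc k) x
zeroSum-tail {n} {k} (I , (i , i∈I) , a , weights , sum≡0) =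
  outside ∷ I , (suc i , there i∈I) , a′ , weights′ , sum≡0
  where
  a′ : Fin (suc k) → ℕ
  a′ zero    = 0
  a′ (suc j) = a j
  weights′ : ∀ j → j ∈ outside ∷ I → InSstar n (a′ j)
  weights′ (suc j) (there j∈I) = weights j j∈I

zeroSum-free⇒< : ∀ {n} .{{_ : NonZero n}} k (x : Fin k → ℕ) → (∀ i → x i < n) → ¬ HasSstarZeroSum n k x →
                 ∀ d → 0 < d → AllHaveZeroSum n d → k < d
zeroSum-free⇒< zero    x x<n free d 0<d allZeroSum = 0<d
zeroSum-free⇒< (suc k) x x<n free d 0<d allZeroSum =
  ≤∧≢⇒< (zeroSum-free⇒< k (x ∘ suc) (x<n ∘ suc) (free ∘ zeroSum-tail {x = x}) d 0<d allZeroSum)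
        (λ { refl → free (allZeroSum x x<n) })

coefficients : ℕ → ℕ → Fin 4 → ℕ
coefficients r u zero                   = 1
coefficients r u (suc zero)             = u
coefficients r u (suc (suc zero))       = r
coefficients r u (suc (suc (suc zero))) = r * u

diagonal≡form : ∀ r u (y : Fin 4 → ℕ) →
  sumFin 4 (λ i → y i * y i * coefficients r u i) ≡ form r u (y zero) (y (suc zero)) (y (suc (suc zero))) (y (suc (suc (suc zero))))
diagonal≡form r u y = expanded r u (y zero) (y (suc zero)) (y (suc (suc zero))) (y (suc (suc (suc zero))))
  where
  expanded : ∀ r u a b c d → a * a * 1 + (b * b * u + (c * c * r + (d * d * (r * u) + 0))) ≡
                             a * a + u * (b * b) + r * (c * c + u * (d * d))
  expanded = solve-∀

module _ {m r u : ℕ} (local : ∀ p → Prime p → p ∣ m → p ∥ r × Anisotropic p u) where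

  descent : ∀ k .{{_ : NonZero k}} → k ∣ m → ∀ a b c d → k * k ∣ form r u a b c d → DividesAll k a b c d
  descent = prime-induction P base step
    where
    P : ℕ → Set
    P k = k ∣ m → ∀ a b c d → k * k ∣ form r u a b c d → DividesAll k a b c d
    base : P 1
    base _ a b c d _ = 1∣ a , 1∣ b , 1∣ c , 1∣ d
    step : ∀ {p k} → Prime p → P k → P (p * k)
    step {p} {k} pp ih pk∣m a b c d pk²∣form with local p pp (∣-trans (m∣m*n k) pk∣m)
    ... | p∥r , anisoₚ
      with p²∣form⇒p∣ {u = u} pp p∥r anisoₚ a b c d (∣-trans (*-pres-∣ (m∣m*n {p} k) (m∣m*n {p} k)) pk²∣form)
    ... | divides-refl a′ , divides-refl b′ , divides-refl c′ , divides-refl d′ =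
      lift (ih (∣-trans (n∣m*n p) pk∣m) a′ b′ c′ d′ k²∣form)
      where
      instance
        _ = prime⇒nonZero pp
        _ = m*n≢0 p p
      square-split : ∀ p k → p * k * (p * k) ≡ p * p * (k * k)
      square-split = solve-∀
      k²∣form : k * k ∣ form r u a′ b′ c′ d′
      k²∣form = *-cancelˡ-∣ (p * p) (subst₂ _∣_ (square-split p k) (form-scale r u a′ b′ c′ d′ p) pk²∣form)
      lift₁ : ∀ {x} → k ∣ x → p * k ∣ x * p
      lift₁ {x} k∣x = subst (_∣ x * p) (*-comm k p) (*-monoˡ-∣ p k∣x)
      lift : DividesAll k a′ b′ c′ d′ → DividesAll (p * k) (a′ * p) (b′ * p) (c′ * p) (d′ * p)
      lift (k∣a′ , k∣b′ , k∣c′ , k∣d′) = lift₁ k∣a′ , lift₁ k∣b′ , lift₁ k∣c′ , lift₁ k∣d′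

  no-zeroSum : .{{_ : NonZero (m * m)}} → ¬ HasSstarZeroSum (m * m) 4 (λ i → coefficients r u i % (m * m))
  no-zeroSum h with zeroSum⇒isotropic (coefficients r u) h
  ... | y , m²∣sum , i , m²∤yᵢ² = m²∤yᵢ² (*-pres-∣ (m∣y i) (m∣y i))
    where
    instance _ = m*n≢0⇒m≢0 m
    divisible = descent m ∣-refl _ _ _ _ (subst (m * m ∣_) (diagonal≡form r u y) m²∣sum)
    m∣y : ∀ i → m ∣ y i
    m∣y zero                   = proj₁ divisible
    m∣y (suc zero)             = proj₁ (proj₂ divisible)
    m∣y (suc (suc zero))       = proj₁ (proj₂ (proj₂ divisible))
    m∣y (suc (suc (suc zero))) = proj₂ (proj₂ (proj₂ divisible))

theorem8 : (n : ℕ) → .{{_ : NonZero n}} → ¬ (2 ∣ n) → Σ ℕ (λ m → n ≡ m * m) →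
    (d : ℕ) → IsDSstar n d → 5 ≤ d
theorem8 _ {{_}} n-odd (m , refl) d (0<d , allZeroSum , _) =
  zeroSum-free⇒< 4 (λ i → coefficients r u i % (m * m)) (λ i → m%n<n _ (m * m)) (no-zeroSum local) d 0<d allZeroSum
  where
  instance _ = m*n≢0⇒m≢0 m
  radical = radical-exists m
  anisotropic = anisotropic-everywhere m (n-odd ∘ ∣m⇒∣m*n m)
  r = proj₁ radical
  u = proj₁ anisotropic
  local : ∀ p → Prime p → p ∣ m → p ∥ r × Anisotropic p u
  local p pp p∣m = proj₂ (proj₂ radical) p pp p∣m , proj₂ anisotropic p pp p∣m
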